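{- Let $G_1=(V_1,E_1)$ and $G_2=(V_2,E_2)$ be graphs with $V_1\cap V_2=\emptyset$, $|V_1|=|V_2|=n>1$, both connected, and having the same multiset of vertex degrees. Let $\sigma_0\in V_1$ be a vertex of maximum degree $d_0$ in $G_1$. For each $\tau\in V_2$ of degree $d_0$ in $G_2$, let $G_\tau=(V_1\cup V_2,\ E_1\cup E_2\cup\{\{\sigma_0,\tau\}\})$. Then $G_1$ and $G_2$ are isomorphic if and only if there exists $\tau\in V_2$ of degree $d_0$ in $G_2$ such that some automorphism of $G_\tau$ maps $\sigma_0$ to $\tau$.
   Context: Graphs are finite, undirected, without loops. $G_1,G_2$ are isomorphic if there is a bijection $\beta:V_1\to V_2$ mapping $E_1$ onto $E_2$ (edges mapped elementwise). An automorphism of a graph $(V,E)$ is a permutation $\pi$ of $V$ with $E\pi=E$. -}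

module Defs where

open import Data.Bool using (Bool; true; false; _∧_)
open import Data.Nat using (ℕ; _≤_)
open import Data.Fin using (Fin; _≟_)
open import Data.List using (List; length; filter; map; _∷_; [])
open import Data.List.Relation.Binary.Permutation.Propositional using (_↭_)
open import Data.Fin using () renaming (_≟_ to _≟ᶠ_)
open import Data.Sum using (_⊎_; inj₁; inj₂)
open import Data.Product using (Σ; _×_; _,_)
open import Function.Bundles using (_↔_; Inverse)
open import Relation.Binary.PropositionalEquality using (_≡_; refl; sym; trans)
open import Relation.Nullary.Decidable using (⌊_⌋)
open import Data.Bool.Properties using (∧-comm)
open import Data.List using (allFin)

record Graph (V : Set) : Set where
  field
    adj    : V → V → Bool
    adj-sym : ∀ u v → adj u v ≡ adj v u
    adj-irr : ∀ v → adj v v ≡ false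
open Graph public

Isomorphic : {V₁ V₂ : Set} → Graph V₁ → Graph V₂ → Set
Isomorphic {V₁} {V₂} G₁ G₂ =
  Σ (V₁ ↔ V₂) λ β → ∀ u v → adj G₁ u v ≡ adj G₂ (Inverse.to β u) (Inverse.to β v)

IsAutomorphism : {V : Set} → Graph V → V ↔ V → Set
IsAutomorphism G π = ∀ u v → adj G u v ≡ adj G (Inverse.to π u) (Inverse.to π v)

data Walk {V : Set} (G : Graph V) : V → V → Set where
  here : ∀ {v} → Walk G v v
  step : ∀ {u w v} → adj G u w ≡ true → Walk G w v → Walk G u v

Connected : {V : Set} → Graph V → Set
Connected G = ∀ u v → Walk G u v

degree : {n : ℕ} → Graph (Fin n) → Fin n → ℕ
degree {n} G u = length (filter (λ v → adj G u v Data.Bool.≟ true) (allFin n))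
  where import Data.Bool

degreeList : {n : ℕ} → Graph (Fin n) → List ℕ
degreeList {n} G = map (degree G) (allFin n)

SameDegreeMultiset : {n : ℕ} → Graph (Fin n) → Graph (Fin n) → Set
SameDegreeMultiset G₁ G₂ = degreeList G₁ ↭ degreeList G₂

IsMaxDegreeVertex : {n : ℕ} → Graph (Fin n) → Fin n → Set
IsMaxDegreeVertex G σ = ∀ v → degree G v ≤ degree G σ

-- The graph G_τ on the disjoint union V₁ ⊎ V₂, with edge set E₁ ∪ E₂ ∪ {{σ₀,τ}}.
joinAdj : {n : ℕ} → Graph (Fin n) → Graph (Fin n) → Fin n → Fin n →
          Fin n ⊎ Fin n → Fin n ⊎ Fin n → Bool
joinAdj G₁ G₂ σ₀ τ (inj₁ a) (inj₁ b) = adj G₁ a b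
joinAdj G₁ G₂ σ₀ τ (inj₂ a) (inj₂ b) = adj G₂ a b
joinAdj G₁ G₂ σ₀ τ (inj₁ a) (inj₂ b) = ⌊ a ≟ᶠ σ₀ ⌋ ∧ ⌊ b ≟ᶠ τ ⌋
joinAdj G₁ G₂ σ₀ τ (inj₂ a) (inj₁ b) = ⌊ b ≟ᶠ σ₀ ⌋ ∧ ⌊ a ≟ᶠ τ ⌋

joinGraph : {n : ℕ} → Graph (Fin n) → Graph (Fin n) → Fin n → Fin n →
            Graph (Fin n ⊎ Fin n)
joinGraph G₁ G₂ σ₀ τ = record
  { adj = joinAdj G₁ G₂ σ₀ τ
  ; adj-sym = s
  ; adj-irr = i
  }
  where
  s : ∀ u v → joinAdj G₁ G₂ σ₀ τ u v ≡ joinAdj G₁ G₂ σ₀ τ v u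
  s (inj₁ a) (inj₁ b) = adj-sym G₁ a b
  s (inj₂ a) (inj₂ b) = adj-sym G₂ a b
  s (inj₁ a) (inj₂ b) = refl
  s (inj₂ a) (inj₁ b) = refl
  i : ∀ v → joinAdj G₁ G₂ σ₀ τ v v ≡ false
  i (inj₁ a) = adj-irr G₁ a
  i (inj₂ a) = adj-irr G₂ a

{-# OPTIONS --safe #-}
module Submission where

-- An isomorphism β : G₁ ≅ G₂ yields the automorphism of G_τ, τ = β σ₀, that exchanges the two
-- copies along β. Conversely let π be an automorphism of G_τ with π σ₀ = τ. Equal degree
-- multisets make τ a vertex of maximum degree in G₂, and the bridge σ₀τ raises its degree above
-- that of every other vertex of V₂; as π τ is a neighbour of π σ₀ = τ of the same degree, π τ = σ₀.
-- So π fixes the bridge, the only edge between V₁ and V₂, and connectivity of G₁ and G₂ then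
-- forces π to exchange V₁ and V₂; its restriction to V₁ is an isomorphism G₁ → G₂.

open import Defs
open import Data.Nat using (ℕ; _<_; _+_; suc)
open import Data.Fin using (Fin)
open import Data.Sum using (_⊎_; inj₁; inj₂)
open import Data.Product using (Σ; _×_)
open import Function.Bundles using (_↔_; _⇔_; Inverse)
open import Relation.Binary.PropositionalEquality using (_≡_)

open import Data.Bool using (true; false; _∧_)
open import Data.Bool.Properties using (∧-comm; ∧-zeroʳ; T-≡; T-∧)
import Data.Bool.Properties as Bool
open import Data.Empty using (⊥-elim)
open import Data.Fin using () renaming (_≟_ to _≟ᶠ_)
open import Data.List using (List; []; _∷_; map; filter; length; allFin; _++_)
open import Data.List.Membership.Propositional using (_∈_; lose)
open import Data.List.Membership.Propositional.Properties
  using (∈-map⁺; ∈-map⁻; ∈-++⁺ˡ; ∈-++⁺ʳ; ∈-allFin)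
open import Data.List.Membership.Propositional.Properties.WithK using (unique∧set⇒bag)
open import Data.List.Properties using (length-++; filter-++; filter-some; filter-none)
open import Data.List.Relation.Binary.BagAndSetEquality using (∼bag⇒↭)
open import Data.List.Relation.Binary.Permutation.Propositional using (_↭_; ↭-sym)
open import Data.List.Relation.Binary.Permutation.Propositional.Properties
  using (↭-length; filter-↭; ∈-resp-↭)
open import Data.List.Relation.Unary.All as All using (All)
import Data.List.Relation.Unary.All.Properties as All
open import Data.List.Relation.Unary.Unique.Propositional using (Unique)
import Data.List.Relation.Unary.Unique.Propositional.Properties as Unique
open import Data.Nat.Properties using (<-irrefl; m<n+m; module ≤-Reasoning)
open import Data.Product using (_,_; proj₁; proj₂; ∃)
open import Data.Sum.Algebra using (⊎-comm)
open import Data.Sum.Function.Propositional using (_⊎-↔_)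
open import Data.Sum.Properties using (inj₁-injective; inj₂-injective)
open import Function using (_∘_)
open import Function.Bundles using (mk⇔; mk↔ₛ′; Injection; Equivalence)
open import Function.Properties.Inverse using (↔-sym; ↔-trans; ↔⇒↣)
open import Relation.Binary.PropositionalEquality
  using (refl; sym; trans; cong; cong₂; subst; subst₂; _≢_; module ≡-Reasoning)
open import Relation.Nullary using (¬_; Dec)
open import Relation.Nullary.Decidable
  using (⌊_⌋; toWitness; isYes≗does; dec-true; dec-false; does-⇔)

open Inverse using (to; from; inverseˡ; inverseʳ; strictlyInverseˡ; strictlyInverseʳ)

private variable
  A B V W : Set

⌊⌋-true : (a? : Dec A) → A → ⌊ a? ⌋ ≡ true
⌊⌋-true a? a = trans (isYes≗does a?) (dec-true a? a)

⌊⌋-false : (a? : Dec A) → ¬ A → ⌊ a? ⌋ ≡ false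
⌊⌋-false a? ¬a = trans (isYes≗does a?) (dec-false a? ¬a)

⌊⌋-⇔ : A ⇔ B → (a? : Dec A) (b? : Dec B) → ⌊ a? ⌋ ≡ ⌊ b? ⌋
⌊⌋-⇔ A⇔B a? b? = trans (isYes≗does a?) (trans (does-⇔ A⇔B a? b?) (sym (isYes≗does b?)))

IsIsomorphism : Graph V → Graph W → V ↔ W → Set
IsIsomorphism G H β = ∀ u v → adj G u v ≡ adj H (to β u) (to β v)

Enumerates : List V → Set
Enumerates {V} vs = Unique vs × (∀ v → v ∈ vs)

allFin-enumerates : ∀ n → Enumerates (allFin n)
allFin-enumerates n = Unique.allFin⁺ n , ∈-allFin

⊎-enumerates : {vs : List V} {ws : List W} → Enumerates vs → Enumerates ws →
               Enumerates (map inj₁ vs ++ map inj₂ ws)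
⊎-enumerates {vs = vs} {ws} (vs! , ∈vs) (ws! , ∈ws) =
  Unique.++⁺ (Unique.map⁺ inj₁-injective vs!) (Unique.map⁺ inj₂-injective ws!) disjoint , complete
  where
  disjoint : ∀ {x} → ¬ (x ∈ map inj₁ vs × x ∈ map inj₂ ws)
  disjoint (x∈₁ , x∈₂) with ∈-map⁻ inj₁ x∈₁ | ∈-map⁻ inj₂ x∈₂
  ... | _ , _ , refl | _ , _ , ()
  complete : ∀ x → x ∈ map inj₁ vs ++ map inj₂ ws
  complete (inj₁ v) = ∈-++⁺ˡ (∈-map⁺ inj₁ (∈vs v))
  complete (inj₂ w) = ∈-++⁺ʳ (map inj₁ vs) (∈-map⁺ inj₂ (∈ws w))

map-↔-↭ : {vs : List V} {ws : List W} (β : V ↔ W) → Enumerates vs → Enumerates ws →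
          map (to β) vs ↭ ws
map-↔-↭ β (vs! , ∈vs) (ws! , ∈ws) = ∼bag⇒↭ (unique∧set⇒bag
  (Unique.map⁺ (Injection.injective (↔⇒↣ β)) vs!) ws!
  (λ {w} → mk⇔ (λ _ → ∈ws w)
    (λ _ → subst (_∈ map (to β) _) (strictlyInverseˡ β w) (∈-map⁺ (to β) (∈vs (from β w))))))

-- degree G u is definitionally degreeIn G (allFin n) u.
degreeIn : Graph V → List V → V → ℕ
degreeIn G vs u = length (filter (λ v → adj G u v Bool.≟ true) vs)

module _ (G : Graph V) where

  degreeIn-↭ : ∀ {vs ws} u → vs ↭ ws → degreeIn G vs u ≡ degreeIn G ws u
  degreeIn-↭ u vs↭ws = ↭-length (filter-↭ _ vs↭ws)

  degreeIn-++ : ∀ vs ws u → degreeIn G (vs ++ ws) u ≡ degreeIn G vs u + degreeIn G ws u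
  degreeIn-++ vs ws u = trans (cong length (filter-++ _ vs ws)) (length-++ (filter _ vs))

  degreeIn-positive : ∀ {vs} u {v} → v ∈ vs → adj G u v ≡ true → 0 < degreeIn G vs u
  degreeIn-positive u v∈vs uv = filter-some _ (lose v∈vs uv)

  degreeIn-zero : ∀ {vs} u → All (λ v → adj G u v ≡ false) vs → degreeIn G vs u ≡ 0
  degreeIn-zero u none = cong length (filter-none _ (All.map Bool.not-¬ none))

degreeIn-map : (G : Graph V) (H : Graph W) (f : V → W) {u : V} →
               (∀ v → adj G u v ≡ adj H (f u) (f v)) →
               ∀ vs → degreeIn H (map f vs) (f u) ≡ degreeIn G vs u
degreeIn-map G H f pres [] = refl
degreeIn-map G H f {u} pres (v ∷ vs) rewrite pres v with adj H (f u) (f v)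
... | true  = cong suc (degreeIn-map G H f pres vs)
... | false = degreeIn-map G H f pres vs

degreeIn-↔ : (G : Graph V) (H : Graph W) {vs : List V} {ws : List W} (β : V ↔ W) →
             IsIsomorphism G H β → Enumerates vs → Enumerates ws →
             ∀ u → degreeIn H ws (to β u) ≡ degreeIn G vs u
degreeIn-↔ G H {vs} β iso enum-vs enum-ws u =
  trans (sym (degreeIn-↭ H (to β u) (map-↔-↭ β enum-vs enum-ws)))
        (degreeIn-map G H (to β) (iso u) vs)

connected-propagate : {G : Graph V} → Connected G → (P : V → Set) →
                      (∀ {u w} → adj G u w ≡ true → P u → P w) →
                      ∀ {u} → P u → ∀ v → P v
connected-propagate {G = G} conn P closed {u} Pu v = along (conn u v) Pu
  where
  along : ∀ {x y} → Walk G x y → P x → P y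
  along here          Px = Px
  along (step xz walk) Px = along walk (closed xz Px)

sameDegreeMultiset-maxDegree : ∀ {n} (G₁ G₂ : Graph (Fin n)) {σ τ} → SameDegreeMultiset G₁ G₂ →
                               IsMaxDegreeVertex G₁ σ → degree G₂ τ ≡ degree G₁ σ →
                               IsMaxDegreeVertex G₂ τ
sameDegreeMultiset-maxDegree G₁ G₂ same maxσ degτ y
  with ∈-map⁻ (degree G₁) (∈-resp-↭ (↭-sym same) (∈-map⁺ (degree G₂) (∈-allFin y)))
... | v , _ , degy≡degv rewrite degy≡degv | degτ = maxσ v

IsIsomorphism-sym : (G : Graph V) (H : Graph W) (β : V ↔ W) →
                    IsIsomorphism G H β → IsIsomorphism H G (↔-sym β)
IsIsomorphism-sym G H β iso u v = begin
  adj H u v                                      ≡⟨ cong₂ (adj H) (sym (strictlyInverseˡ β u))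
                                                                  (sym (strictlyInverseˡ β v)) ⟩
  adj H (to β (from β u)) (to β (from β v))      ≡⟨ sym (iso (from β u) (from β v)) ⟩
  adj G (from β u) (from β v)                    ∎
  where open ≡-Reasoning

swapAlong : V ↔ W → (V ⊎ W) ↔ (V ⊎ W)
swapAlong β = ↔-trans (β ⊎-↔ ↔-sym β) (⊎-comm _ _)

crossing-swapAlong : ∀ {n} (σ₀ : Fin n) (β : Fin n ↔ Fin n) u v →
                     ⌊ u ≟ᶠ σ₀ ⌋ ∧ ⌊ v ≟ᶠ to β σ₀ ⌋ ≡ ⌊ from β v ≟ᶠ σ₀ ⌋ ∧ ⌊ to β u ≟ᶠ to β σ₀ ⌋
crossing-swapAlong σ₀ β u v = trans
  (cong₂ _∧_ (⌊⌋-⇔ (mk⇔ (cong (to β)) (Injection.injective (↔⇒↣ β))) (u ≟ᶠ σ₀) (to β u ≟ᶠ to β σ₀))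
             (⌊⌋-⇔ (mk⇔ (inverseʳ β) (sym ∘ inverseˡ β ∘ sym)) (v ≟ᶠ to β σ₀) (from β v ≟ᶠ σ₀)))
  (∧-comm ⌊ to β u ≟ᶠ to β σ₀ ⌋ ⌊ from β v ≟ᶠ σ₀ ⌋)

swapAlong-automorphism : ∀ {n} (G₁ G₂ : Graph (Fin n)) σ₀ (β : Fin n ↔ Fin n) →
                         IsIsomorphism G₁ G₂ β →
                         IsAutomorphism (joinGraph G₁ G₂ σ₀ (to β σ₀)) (swapAlong β)
swapAlong-automorphism G₁ G₂ σ₀ β iso (inj₁ u) (inj₁ v) = iso u v
swapAlong-automorphism G₁ G₂ σ₀ β iso (inj₂ u) (inj₂ v) = IsIsomorphism-sym G₁ G₂ β iso u v
swapAlong-automorphism G₁ G₂ σ₀ β iso (inj₁ u) (inj₂ v) = crossing-swapAlong σ₀ β u v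
swapAlong-automorphism G₁ G₂ σ₀ β iso (inj₂ u) (inj₁ v) = crossing-swapAlong σ₀ β v u

module _ (π : (V ⊎ W) ↔ (V ⊎ W))
         (left→right : ∀ v → ∃ λ w → to π (inj₁ v) ≡ inj₂ w)
         (right→left : ∀ w → ∃ λ v → to π (inj₂ w) ≡ inj₁ v) where

  private
    from-right : ∀ w → ∃ λ v → from π (inj₂ w) ≡ inj₁ v
    from-right w with from π (inj₂ w) in π⁻¹w≡x
    ... | inj₁ v = v , refl
    ... | inj₂ w′ with right→left w′
    ...   | v , πw′≡v with () ← trans (sym πw′≡v)
                                      (trans (cong (to π) (sym π⁻¹w≡x)) (strictlyInverseˡ π (inj₂ w)))

  restrict : V ↔ W
  restrict = mk↔ₛ′ (proj₁ ∘ left→right) (proj₁ ∘ from-right) to∘from from∘to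
    where
    to∘from : ∀ w → proj₁ (left→right (proj₁ (from-right w))) ≡ w
    to∘from w = inj₂-injective (begin
      inj₂ _                          ≡⟨ sym (proj₂ (left→right _)) ⟩
      to π (inj₁ _)                   ≡⟨ cong (to π) (sym (proj₂ (from-right w))) ⟩
      to π (from π (inj₂ w))          ≡⟨ strictlyInverseˡ π (inj₂ w) ⟩
      inj₂ w                          ∎)
      where open ≡-Reasoning
    from∘to : ∀ v → proj₁ (from-right (proj₁ (left→right v))) ≡ v
    from∘to v = inj₁-injective (begin
      inj₁ _                          ≡⟨ sym (proj₂ (from-right _)) ⟩
      from π (inj₂ _)                 ≡⟨ cong (from π) (sym (proj₂ (left→right v))) ⟩
      from π (to π (inj₁ v))          ≡⟨ strictlyInverseʳ π (inj₁ v) ⟩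
      inj₁ v                          ∎)
      where open ≡-Reasoning

  to-restrict : ∀ v → to π (inj₁ v) ≡ inj₂ (to restrict v)
  to-restrict v = proj₂ (left→right v)

module Join {n} (G₁ G₂ : Graph (Fin n)) (σ₀ τ : Fin n) where

  Gτ : Graph (Fin n ⊎ Fin n)
  Gτ = joinGraph G₁ G₂ σ₀ τ

  V₁ V₂ vertices : List (Fin n ⊎ Fin n)
  V₁ = map inj₁ (allFin n)
  V₂ = map inj₂ (allFin n)
  vertices = V₁ ++ V₂

  vertices-enumerates : Enumerates vertices
  vertices-enumerates = ⊎-enumerates (allFin-enumerates n) (allFin-enumerates n)

  bridge : adj Gτ (inj₁ σ₀) (inj₂ τ) ≡ true
  bridge = cong₂ _∧_ (⌊⌋-true (σ₀ ≟ᶠ σ₀) refl) (⌊⌋-true (τ ≟ᶠ τ) refl)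

  crossing-edge : ∀ {a b} → adj Gτ (inj₁ a) (inj₂ b) ≡ true → a ≡ σ₀ × b ≡ τ
  crossing-edge {a} {b} ab with Equivalence.to (T-∧ {⌊ a ≟ᶠ σ₀ ⌋}) (Equivalence.from T-≡ ab)
  ... | a≟σ₀ , b≟τ = toWitness a≟σ₀ , toWitness b≟τ

  degree-inj₂ : ∀ y → degreeIn Gτ vertices (inj₂ y) ≡ degreeIn Gτ V₁ (inj₂ y) + degree G₂ y
  degree-inj₂ y = begin
    degreeIn Gτ vertices (inj₂ y)
      ≡⟨ degreeIn-++ Gτ V₁ V₂ (inj₂ y) ⟩
    degreeIn Gτ V₁ (inj₂ y) + degreeIn Gτ V₂ (inj₂ y)
      ≡⟨ cong (degreeIn Gτ V₁ (inj₂ y) +_) (degreeIn-map G₂ Gτ inj₂ (λ _ → refl) (allFin n)) ⟩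
    degreeIn Gτ V₁ (inj₂ y) + degree G₂ y
      ∎
    where open ≡-Reasoning

  degree-inj₂-τ : degree G₂ τ < degreeIn Gτ vertices (inj₂ τ)
  degree-inj₂-τ rewrite degree-inj₂ τ =
    m<n+m (degree G₂ τ) (degreeIn-positive Gτ (inj₂ τ) (∈-map⁺ inj₁ (∈-allFin σ₀)) bridge)

  degree-inj₂-≢τ : ∀ {y} → y ≢ τ → degreeIn Gτ vertices (inj₂ y) ≡ degree G₂ y
  degree-inj₂-≢τ {y} y≢τ = trans (degree-inj₂ y)
    (cong (_+ degree G₂ y)
          (degreeIn-zero Gτ (inj₂ y) (All.map⁺ (All.universal no-crossing (allFin n)))))
    where
    no-crossing : ∀ b → adj Gτ (inj₂ y) (inj₁ b) ≡ false
    no-crossing b = trans (cong (⌊ b ≟ᶠ σ₀ ⌋ ∧_) (⌊⌋-false (y ≟ᶠ τ) y≢τ)) (∧-zeroʳ _)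

  module _ {π : (Fin n ⊎ Fin n) ↔ (Fin n ⊎ Fin n)} (aut : IsAutomorphism Gτ π)
           (πσ₀ : to π (inj₁ σ₀) ≡ inj₂ τ) where

    private
      π-injective : ∀ {x y} → to π x ≡ to π y → x ≡ y
      π-injective = Injection.injective (↔⇒↣ π)

      edge-image : ∀ {x y} → adj Gτ x y ≡ true → adj Gτ (to π x) (to π y) ≡ true
      edge-image {x} {y} xy = trans (sym (aut x y)) xy

      deg : Fin n ⊎ Fin n → ℕ
      deg = degreeIn Gτ vertices

    πτ-adjacent : ∀ {x} → to π (inj₂ τ) ≡ x → adj Gτ (inj₂ τ) x ≡ true
    πτ-adjacent refl = subst (λ x → adj Gτ x (to π (inj₂ τ)) ≡ true) πσ₀ (edge-image bridge)

    πτ≢inj₂ : IsMaxDegreeVertex G₂ τ → ∀ y → to π (inj₂ τ) ≢ inj₂ y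
    πτ≢inj₂ maxτ y πτ≡y = <-irrefl refl (begin-strict
      degree G₂ y             ≤⟨ maxτ y ⟩
      degree G₂ τ             <⟨ degree-inj₂-τ ⟩
      deg (inj₂ τ)            ≡⟨ degreeIn-↔ Gτ Gτ π aut vertices-enumerates vertices-enumerates _ ⟨
      deg (to π (inj₂ τ))     ≡⟨ cong deg πτ≡y ⟩
      deg (inj₂ y)            ≡⟨ degree-inj₂-≢τ y≢τ ⟩
      degree G₂ y             ∎)
      where
      open ≤-Reasoning
      y≢τ : y ≢ τ
      y≢τ refl = Bool.not-¬ (adj-irr G₂ τ) (πτ-adjacent πτ≡y)

    πτ≡σ₀ : IsMaxDegreeVertex G₂ τ → to π (inj₂ τ) ≡ inj₁ σ₀
    -- joinAdj is literally symmetric on crossing pairs, so crossing-edge applies to (inj₂ τ, inj₁ b).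
    πτ≡σ₀ maxτ with to π (inj₂ τ) in πτ≡x
    ... | inj₁ b = cong inj₁ (proj₁ (crossing-edge (πτ-adjacent πτ≡x)))
    ... | inj₂ y = ⊥-elim (πτ≢inj₂ maxτ y πτ≡x)

    module _ (πτ : to π (inj₂ τ) ≡ inj₁ σ₀) where

      crossing-preimage : ∀ {x y a b} → adj Gτ x y ≡ true → to π x ≡ inj₁ a → to π y ≡ inj₂ b →
                          x ≡ inj₂ τ × y ≡ inj₁ σ₀
      crossing-preimage {a = a} {b} xy πx πy
        with crossing-edge {a} {b} (subst₂ (λ s t → adj Gτ s t ≡ true) πx πy (edge-image xy))
      ... | refl , refl = π-injective (trans πx (sym πτ)) , π-injective (trans πy (sym πσ₀))

      left→right : Connected G₁ → ∀ a → ∃ λ b → to π (inj₁ a) ≡ inj₂ b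
      left→right conn₁ = connected-propagate conn₁ _ closed (τ , πσ₀)
        where
        closed : ∀ {u w} → adj G₁ u w ≡ true → (∃ λ b → to π (inj₁ u) ≡ inj₂ b) →
                 ∃ λ b → to π (inj₁ w) ≡ inj₂ b
        closed {u} {w} uw (_ , πu) with to π (inj₁ w) in πw
        ... | inj₂ b = b , refl
        ... | inj₁ _ with () ← proj₁ (crossing-preimage (trans (adj-sym G₁ w u) uw) πw πu)

      right→left : Connected G₂ → ∀ b → ∃ λ a → to π (inj₂ b) ≡ inj₁ a
      right→left conn₂ = connected-propagate conn₂ _ closed (σ₀ , πτ)
        where
        closed : ∀ {u w} → adj G₂ u w ≡ true → (∃ λ a → to π (inj₂ u) ≡ inj₁ a) →
                 ∃ λ a → to π (inj₂ w) ≡ inj₁ a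
        closed {u} {w} uw (_ , πu) with to π (inj₂ w) in πw
        ... | inj₁ a = a , refl
        ... | inj₂ _ with () ← proj₂ (crossing-preimage uw πu πw)

    swapping-automorphism⇒isomorphic : Connected G₁ → Connected G₂ → IsMaxDegreeVertex G₂ τ →
                                       Isomorphic G₁ G₂
    swapping-automorphism⇒isomorphic conn₁ conn₂ maxτ = β , λ u v → begin
      adj G₁ u v                               ≡⟨ aut (inj₁ u) (inj₁ v) ⟩
      adj Gτ (to π (inj₁ u)) (to π (inj₁ v))   ≡⟨ cong₂ (adj Gτ) (to-restrict π l→r r→l u)
                                                                 (to-restrict π l→r r→l v) ⟩
      adj G₂ (to β u) (to β v)                 ∎
      where
      open ≡-Reasoning
      πτ : to π (inj₂ τ) ≡ inj₁ σ₀
      πτ = πτ≡σ₀ maxτ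
      l→r : ∀ a → ∃ λ b → to π (inj₁ a) ≡ inj₂ b
      l→r = left→right πτ conn₁
      r→l : ∀ b → ∃ λ a → to π (inj₂ b) ≡ inj₁ a
      r→l = right→left πτ conn₂
      β : Fin n ↔ Fin n
      β = restrict π l→r r→l

lemma2 : (n : ℕ) → 1 < n → (G₁ G₂ : Graph (Fin n)) →
         Connected G₁ → Connected G₂ → SameDegreeMultiset G₁ G₂ →
         (σ₀ : Fin n) → IsMaxDegreeVertex G₁ σ₀ →
         Isomorphic G₁ G₂ ⇔
           (Σ (Fin n) λ τ → degree G₂ τ ≡ degree G₁ σ₀ ×
             Σ ((Fin n ⊎ Fin n) ↔ (Fin n ⊎ Fin n)) λ π →
               IsAutomorphism (joinGraph G₁ G₂ σ₀ τ) π ×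
               Inverse.to π (inj₁ σ₀) ≡ inj₂ τ)
lemma2 n _ G₁ G₂ conn₁ conn₂ same σ₀ maxσ₀ = mk⇔
  (λ (β , iso) →
    to β σ₀ , degreeIn-↔ G₁ G₂ β iso (allFin-enumerates n) (allFin-enumerates n) σ₀ ,
    swapAlong β , swapAlong-automorphism G₁ G₂ σ₀ β iso , refl)
  (λ (τ , degτ , π , aut , πσ₀) →
    Join.swapping-automorphism⇒isomorphic G₁ G₂ σ₀ τ {π} aut πσ₀ conn₁ conn₂
      (sameDegreeMultiset-maxDegree G₁ G₂ same maxσ₀ degτ))
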